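{- Let $q$ be a prime power, $\mathbb{F}_q$ the field with $q$ elements, and $E \subset \mathbb{F}_q^2$. Then the following hold. (i) Suppose that $|E|>q$. Then $|V_2(E)| \geq \frac{q-1}{2}$. Moreover, the triangles giving at least $\frac{q-1}{2}$ distinct areas can be chosen to share the same base: there exist distinct points $e_1,e_2\in E$ and points $x_1,\dots,x_m\in E$ with $m\geq \frac{q-1}{2}$ such that the values $\det(e_1-x_i,\,e_2-x_i)$, $i=1,\dots,m$, are nonzero and pairwise distinct. (ii) There is an absolute constant $C$ such that if $q\geq C$ and $|E| \ge 64q \log_2 q$, then there exists $z \in E$ such that $|V^z_2(E)| > \frac{q}{2}$.
   Context: For $E\subseteq\mathbb{F}_q^2$, $V_2(E)=\{\det(x^1-x^3,\,x^2-x^3): x^1,x^2,x^3\in E\}\setminus\{0\}$ is the set of nonzero (signed, determinant-normalized) triangle areas determined by $E$, and for fixed $z\in E$, $V_2^z(E)=\{\det(x^1-z,\,x^2-z): x^1,x^2\in E\}\setminus\{0\}$ is the set of pinned nonzero areas at vertex $z$. Here $\det(u,v)$ denotes the determinant of the $2\times 2$ matrix with columns $u,v$. -}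

module Defs where

open import Data.Nat using (ℕ)
open import Data.Fin using (Fin)
open import Data.Product using (_×_; _,_; proj₁; proj₂)
open import Data.Product.Properties using (≡-dec)
open import Data.List using (List; concatMap; map; filter; deduplicate; length)
open import Relation.Nullary using (¬_; ¬?)
open import Relation.Binary using (DecidableEquality)
open import Relation.Binary.PropositionalEquality using (_≡_)
open import Algebra.Structures using (IsCommutativeRing)
open import Function.Bundles using (Bijection)
open import Relation.Binary.PropositionalEquality using (setoid)

-- A finite field with exactly q elements (equality is propositional).
-- (Such a field exists iff q is a prime power, and it is then unique up
-- to isomorphism; quantifying over all of them is F_q.)
record FiniteField (q : ℕ) : Set₁ where
  field
    Carrier : Set
    _+_ _*_ : Carrier → Carrier → Carrier
    -_ : Carrier → Carrier
    0# 1# : Carrier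
    isCommutativeRing : IsCommutativeRing _≡_ _+_ _*_ -_ 0# 1#
    0≢1 : ¬ (0# ≡ 1#)
    _⁻¹ : Carrier → Carrier
    inverseʳ : ∀ x → ¬ (x ≡ 0#) → x * (x ⁻¹) ≡ 1#
    _≟_ : DecidableEquality Carrier
    enumeration : Bijection (setoid (Fin q)) (setoid Carrier)

  infixl 6 _+_
  infixl 7 _*_

  _-_ : Carrier → Carrier → Carrier
  x - y = x + (- y)
  infixl 6 _-_

  Point : Set
  Point = Carrier × Carrier

  _≟ₚ_ : DecidableEquality Point
  _≟ₚ_ = ≡-dec _≟_ _≟_

  _-ₚ_ : Point → Point → Point
  (a , b) -ₚ (c , d) = (a - c , b - d)

  det : Point → Point → Carrier
  det (u₁ , u₂) (v₁ , v₂) = u₁ * v₂ - u₂ * v₁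

  nonzeroValues : List Carrier → List Carrier
  nonzeroValues vs = deduplicate _≟_ (filter (λ v → ¬? (v ≟ 0#)) vs)

  V₂ : List Point → List Carrier
  V₂ E = nonzeroValues
    (concatMap (λ x₁ → concatMap (λ x₂ → map (λ x₃ → det (x₁ -ₚ x₃) (x₂ -ₚ x₃)) E) E) E)

  V₂pin : Point → List Point → List Carrier
  V₂pin z E = nonzeroValues
    (concatMap (λ x₁ → map (λ x₂ → det (x₁ -ₚ z) (x₂ -ₚ z)) E) E)

module Submission where

-- The q + 1 parallel
-- classes of lines in F² are indexed by a `Direction`; `level t x` names the
-- line of direction t through x.  Two distinct points lie on a common line
-- of at most one direction.  A double count of collinear pairs (the
-- "energy" of each projection `level t`) shows that for a set E of q + 1
-- points some direction t meets E in at least (q + 1) / 2 distinct lines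
-- (`someLargeImage`).  Since |E| > q, two distinct points p, p' of E lie on
-- one line of direction t; the area det(p - x, p' - x) equals
-- c · (level t x - level t p) with c ≠ 0 (`areaAlongLine`), so one point of E
-- on each other line of direction t gives distinct nonzero areas with base
-- p p' (`sameBaseAreas`).  By `areaPinned` those are also areas pinned at p,
-- which gives part (ii) with C = 9: the hypothesis q^(64q) ≤ 2^|E| forces
-- |E| ≥ 64q ≥ q + 4, and a set of q + 4 points suffices once q ≥ 9.

open import Defs
open import Data.Nat using (ℕ; zero; suc; z≤n; s≤s; _∸_; _^_)
  renaming (_+_ to _+ℕ_; _*_ to _*ℕ_; _≤_ to _≤ℕ_; _<_ to _<ℕ_)
import Data.Nat.Properties as ℕP
open import Data.Nat.Tactic.RingSolver using (solve-∀)
open import Data.Integer as ℤ using (ℤ; -[1+_])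
import Data.Integer.Properties as ℤP
open import Data.Maybe using (Maybe; just; nothing)
open import Data.List using (List; []; _∷_; length; map; filter; take; deduplicate; concatMap; allFin)
import Data.List.Properties as ListP
import Data.List.Relation.Binary.Sublist.Propositional.Properties as SublistP
open import Data.List.Relation.Unary.All as All using (All; []; _∷_)
import Data.List.Relation.Unary.All.Properties as AllP
open import Data.List.Relation.Unary.Any as Any using (here; there)
open import Data.List.Relation.Unary.AllPairs using ([]; _∷_)
open import Data.List.Relation.Unary.Unique.Propositional using (Unique)
import Data.List.Relation.Unary.Unique.Propositional.Properties as UniqueP
import Data.List.Relation.Unary.Unique.DecPropositional.Properties as DecUniqueP
open import Data.List.Membership.Propositional using (_∈_; find)
import Data.List.Membership.Propositional.Properties as ∈P
open import Data.Product using (Σ; _×_; _,_; proj₁; proj₂; ∃)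
open import Data.Sum using (_⊎_; inj₁; inj₂)
open import Data.Empty using (⊥; ⊥-elim)
open import Relation.Nullary using (¬_; Dec; yes; no; ¬?)
open import Relation.Binary using (DecidableEquality)
open import Relation.Binary.PropositionalEquality
open import Function.Bundles using (Bijection)
open import Algebra.Bundles using (CommutativeRing)
open import Algebra.Structures using (IsCommutativeRing)
open import Algebra.Solver.Ring.AlmostCommutativeRing
  using (AlmostCommutativeRing; _-Raw-AlmostCommutative⟶_; fromCommutativeRing)

-- A ring solver for any commutative ring whose equality is propositional:
-- the canonical map ℤ → R is a ring morphism, so R can be normalised with
-- integer coefficients.
module IntegerRingSolver
  {A : Set} {add mul : A → A → A} {neg : A → A} {zero₀ one : A}
  (isCommutativeRing : IsCommutativeRing _≡_ add mul neg zero₀ one) where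

  commutativeRing : CommutativeRing _ _
  commutativeRing = record { isCommutativeRing = isCommutativeRing }

  open CommutativeRing commutativeRing
    using (_+_; _*_; -_; 0#; 1#; +-assoc; +-comm; +-identityˡ; +-identityʳ; zeroˡ; zeroʳ; -‿inverseʳ;
           ring; semiring; +-abelianGroup)
  open import Algebra.Properties.Ring ring using (-‿distribˡ-*; -‿distribʳ-*; -‿involutive; -0#≈0#)
  open import Algebra.Properties.AbelianGroup +-abelianGroup using (⁻¹-∙-comm)
  open import Algebra.Properties.Semiring.Mult semiring using (×-homo-+; ×1-homo-*)
    renaming (_×_ to _×ₙ_)
  open ≡-Reasoning

  private
    infixl 6 _-_
    _-_ : A → A → A
    a - b = a + - b

    ν : ℕ → A
    ν n = n ×ₙ 1#

  ι : ℤ → A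
  ι (ℤ.+ n) = ν n
  ι -[1+ n ] = - ν (suc n)

  private
    sub-suc : ∀ a b → (1# + a) - (1# + b) ≡ a - b
    sub-suc a b = begin
      (1# + a) + - (1# + b)       ≡⟨ cong ((1# + a) +_) (sym (⁻¹-∙-comm 1# b)) ⟩
      (1# + a) + (- 1# + - b)     ≡⟨ cong (_+ (- 1# + - b)) (+-comm 1# a) ⟩
      (a + 1#) + (- 1# + - b)     ≡⟨ +-assoc a 1# _ ⟩
      a + (1# + (- 1# + - b))     ≡⟨ cong (a +_) (sym (+-assoc _ _ _)) ⟩
      a + ((1# + - 1#) + - b)     ≡⟨ cong (λ z → a + (z + - b)) (-‿inverseʳ 1#) ⟩
      a + (0# + - b)              ≡⟨ cong (a +_) (+-identityˡ _) ⟩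
      a - b                       ∎

    ι-⊖ : ∀ m n → ι (m ℤ.⊖ n) ≡ ν m - ν n
    ι-⊖ m zero = begin
      ι (m ℤ.⊖ 0)    ≡⟨ cong ι (ℤP.⊖-≥ {m} {0} z≤n) ⟩
      ν m            ≡⟨ sym (+-identityʳ _) ⟩
      ν m + 0#       ≡⟨ cong (ν m +_) (sym -0#≈0#) ⟩
      ν m - 0#       ∎
    ι-⊖ zero (suc n) = begin
      ι (0 ℤ.⊖ suc n)  ≡⟨ cong ι (ℤP.⊖-< {0} {suc n} (s≤s z≤n)) ⟩
      - ν (suc n)      ≡⟨ sym (+-identityˡ _) ⟩
      0# - ν (suc n)   ∎
    ι-⊖ (suc m) (suc n) = begin
      ι (suc m ℤ.⊖ suc n)    ≡⟨ cong ι (ℤP.[1+m]⊖[1+n]≡m⊖n m n) ⟩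
      ι (m ℤ.⊖ n)            ≡⟨ ι-⊖ m n ⟩
      ν m - ν n              ≡⟨ sym (sub-suc _ _) ⟩
      ν (suc m) - ν (suc n)  ∎

    ι-+ : ∀ a b → ι (a ℤ.+ b) ≡ ι a + ι b
    ι-+ (ℤ.+ m) (ℤ.+ n) = ×-homo-+ 1# m n
    ι-+ (ℤ.+ m) -[1+ n ] = ι-⊖ m (suc n)
    ι-+ -[1+ m ] (ℤ.+ n) = trans (ι-⊖ n (suc m)) (+-comm _ _)
    ι-+ -[1+ m ] -[1+ n ] = begin
      - ν (suc (suc (m +ℕ n)))     ≡⟨ cong (λ k → - ν (suc k)) (sym (ℕP.+-suc m n)) ⟩
      - ν (suc m +ℕ suc n)         ≡⟨ cong -_ (×-homo-+ 1# (suc m) (suc n)) ⟩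
      - (ν (suc m) + ν (suc n))    ≡⟨ sym (⁻¹-∙-comm _ _) ⟩
      - ν (suc m) + - ν (suc n)    ∎

    ι-neg : ∀ a → ι (ℤ.- a) ≡ - ι a
    ι-neg (ℤ.+ zero) = sym -0#≈0#
    ι-neg (ℤ.+ suc n) = refl
    ι-neg -[1+ n ] = sym (-‿involutive _)

    ι-* : ∀ a b → ι (a ℤ.* b) ≡ ι a * ι b
    ι-* (ℤ.+ m) (ℤ.+ n) = trans (cong ι (ℤP.+◃n≡+n (m *ℕ n))) (×1-homo-* m n)
    ι-* (ℤ.+ zero) -[1+ n ] = sym (zeroˡ _)
    ι-* (ℤ.+ suc m) -[1+ n ] = begin
      - ν (suc m *ℕ suc n)        ≡⟨ cong -_ (×1-homo-* (suc m) (suc n)) ⟩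
      - (ν (suc m) * ν (suc n))   ≡⟨ -‿distribʳ-* _ _ ⟩
      ν (suc m) * - ν (suc n)     ∎
    ι-* -[1+ m ] (ℤ.+ zero) rewrite ℕP.*-zeroʳ m = sym (zeroʳ _)
    ι-* -[1+ m ] (ℤ.+ suc n) = begin
      - ν (suc m *ℕ suc n)        ≡⟨ cong -_ (×1-homo-* (suc m) (suc n)) ⟩
      - (ν (suc m) * ν (suc n))   ≡⟨ -‿distribˡ-* _ _ ⟩
      - ν (suc m) * ν (suc n)     ∎
    ι-* -[1+ m ] -[1+ n ] = begin
      ν (suc m *ℕ suc n)              ≡⟨ ×1-homo-* (suc m) (suc n) ⟩
      ν (suc m) * ν (suc n)           ≡⟨ sym (-‿involutive _) ⟩
      - - (ν (suc m) * ν (suc n))     ≡⟨ cong -_ (-‿distribˡ-* _ _) ⟩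
      - (- ν (suc m) * ν (suc n))     ≡⟨ -‿distribʳ-* _ _ ⟩
      - ν (suc m) * - ν (suc n)       ∎

  almostCommutativeRing : AlmostCommutativeRing _ _
  almostCommutativeRing = fromCommutativeRing commutativeRing

  integerMorphism : ℤ.+-*-rawRing -Raw-AlmostCommutative⟶ almostCommutativeRing
  integerMorphism = record
    { ⟦_⟧ = ι ; +-homo = ι-+ ; *-homo = ι-* ; -‿homo = ι-neg
    ; 0-homo = refl ; 1-homo = +-identityʳ 1# }

  private
    equalCoefficients : ∀ a b → Maybe (ι a ≡ ι b)
    equalCoefficients a b with a ℤ.≟ b
    ... | yes refl = just refl
    ... | no _ = nothing

  open import Algebra.Solver.Ring ℤ.+-*-rawRing almostCommutativeRing integerMorphism equalCoefficients
    public using (solve; _:=_; _:+_; _:-_; _:*_; con)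

module Counting where
  open import Algebra.Properties.CommutativeSemigroup ℕP.+-commutativeSemigroup
    using (interchange; x∙yz≈y∙xz)

  private variable
    A B : Set

  ∑ : List A → (A → ℕ) → ℕ
  ∑ [] f = 0
  ∑ (x ∷ xs) f = f x +ℕ ∑ xs f

  syntax ∑ xs (λ x → e) = ∑[ x ∈ xs ] e

  ∑-cong : ∀ {f g : A → ℕ} xs → (∀ x → f x ≡ g x) → ∑ xs f ≡ ∑ xs g
  ∑-cong [] e = refl
  ∑-cong (x ∷ xs) e = cong₂ _+ℕ_ (e x) (∑-cong xs e)

  ∑-+ : ∀ (f g : A → ℕ) xs → ∑[ x ∈ xs ] (f x +ℕ g x) ≡ ∑ xs f +ℕ ∑ xs g
  ∑-+ f g [] = refl
  ∑-+ f g (x ∷ xs) rewrite ∑-+ f g xs = interchange (f x) (g x) (∑ xs f) (∑ xs g)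

  ∑-mono : ∀ {f g : A → ℕ} {xs} → All (λ x → f x ≤ℕ g x) xs → ∑ xs f ≤ℕ ∑ xs g
  ∑-mono [] = z≤n
  ∑-mono (p ∷ ps) = ℕP.+-mono-≤ p (∑-mono ps)

  ∑-const : ∀ (c : ℕ) (f : A → ℕ) {xs} → All (λ x → f x ≡ c) xs → ∑ xs f ≡ length xs *ℕ c
  ∑-const c f [] = refl
  ∑-const c f (p ∷ ps) = cong₂ _+ℕ_ p (∑-const c f ps)

  ∑-zero : ∀ (f : A → ℕ) {xs} → All (λ x → f x ≡ 0) xs → ∑ xs f ≡ 0
  ∑-zero f {xs} zeros = trans (∑-const 0 f zeros) (ℕP.*-zeroʳ (length xs))

  ∑-one : ∀ (xs : List A) → ∑[ x ∈ xs ] 1 ≡ length xs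
  ∑-one xs = trans (∑-const 1 (λ _ → 1) {xs} (All.tabulate (λ _ → refl))) (ℕP.*-identityʳ (length xs))

  ∑-swap : ∀ (f : A → B → ℕ) (xs : List A) (ys : List B) →
    ∑[ x ∈ xs ] ∑[ y ∈ ys ] f x y ≡ ∑[ y ∈ ys ] ∑[ x ∈ xs ] f x y
  ∑-swap f [] ys = sym (∑-zero (λ _ → 0) {ys} (All.tabulate (λ _ → refl)))
  ∑-swap f (x ∷ xs) ys rewrite ∑-swap f xs ys = sym (∑-+ (f x) (λ y → ∑[ x ∈ xs ] f x y) ys)

  ∑-filter : ∀ {P : A → Set} (P? : ∀ x → Dec (P x)) (f : A → ℕ) xs →
    ∑ xs f ≡ ∑ (filter P? xs) f +ℕ ∑ (filter (λ x → ¬? (P? x)) xs) f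
  ∑-filter P? f [] = refl
  ∑-filter P? f (x ∷ xs) with P? x
  ... | yes _ = trans (cong (f x +ℕ_) (∑-filter P? f xs)) (sym (ℕP.+-assoc (f x) _ _))
  ... | no _ = trans (cong (f x +ℕ_) (∑-filter P? f xs)) (x∙yz≈y∙xz (f x) (∑ (filter P? xs) f) _)

  indicator : {P : Set} → Dec P → ℕ
  indicator (yes _) = 1
  indicator (no _) = 0

  indicator≤1 : {P : Set} (d : Dec P) → indicator d ≤ℕ 1
  indicator≤1 (yes _) = s≤s z≤n
  indicator≤1 (no _) = z≤n

  unique-length-≤ : (_≟_ : DecidableEquality A) → ∀ xs ys → Unique xs → All (_∈ ys) xs → length xs ≤ℕ length ys
  unique-length-≤ _≟_ [] ys _ _ = z≤n
  unique-length-≤ _≟_ (x ∷ xs) ys (x∉xs ∷ u) (x∈ys ∷ xs⊆ys) =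
    ℕP.≤-trans (s≤s (unique-length-≤ _≟_ xs ys′ u xs⊆ys′)) removing-x-shrinks
    where
    ys′ = filter (λ y → ¬? (y ≟ x)) ys
    xs⊆ys′ : All (_∈ ys′) xs
    xs⊆ys′ = All.zipWith (λ (x≢y , y∈ys) → ∈P.∈-filter⁺ (λ y → ¬? (y ≟ x)) y∈ys (λ e → x≢y (sym e))) (x∉xs , xs⊆ys)
    removing-x-shrinks : length ys′ <ℕ length ys
    removing-x-shrinks = ListP.filter-notAll (λ y → ¬? (y ≟ x)) ys (Any.map (λ e ne → ne (sym e)) x∈ys)

  remove-one : (_≟_ : DecidableEquality A) → ∀ a V → Unique V →
    length V ≤ℕ suc (length (filter (λ v → ¬? (v ≟ a)) V))
  remove-one _≟_ a [] u = z≤n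
  remove-one _≟_ a (v ∷ V) (v∉V ∷ u) with v ≟ a
  ... | yes refl = s≤s (ℕP.≤-reflexive (sym (cong length (ListP.filter-all (λ w → ¬? (w ≟ v)) (All.map (λ ne e → ne (sym e)) v∉V)))))
  ... | no _ = s≤s (remove-one _≟_ a V u)

  preimages : ∀ (g : A → B) (E : List A) (vs : List B) → All (_∈ map g E) vs →
    Σ (List A) (λ xs → All (_∈ E) xs × map g xs ≡ vs)
  preimages g E [] [] = [] , [] , refl
  preimages g E (v ∷ vs) (v∈gE ∷ vs⊆gE) with ∈P.∈-map⁻ g v∈gE | preimages g E vs vs⊆gE
  ... | x , x∈E , v≡gx | xs , xs⊆E , gxs≡vs = x ∷ xs , x∈E ∷ xs⊆E , cong₂ _∷_ (sym v≡gx) gxs≡vs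

  subsetOfSize : ∀ n (E : List A) → Unique E → n ≤ℕ length E →
    Σ (List A) (λ E′ → Unique E′ × length E′ ≡ n × All (_∈ E) E′)
  subsetOfSize n E uE n≤|E| =
    take n E , UniqueP.take⁺ n uE ,
    trans (ListP.length-take n E) (ℕP.m≤n⇒m⊓n≡m n≤|E|) ,
    All.tabulate (SublistP.Any-resp-⊆ (SublistP.take-⊆ n E))

module Fibres {A B : Set} (_≟_ : DecidableEquality B) (g : A → B) where
  open Counting

  fibreSize : List A → B → ℕ
  fibreSize E b = ∑[ x ∈ E ] indicator (g x ≟ b)

  energy : List A → ℕ
  energy E = ∑[ p ∈ E ] fibreSize E (g p)

  image : List A → List B
  image E = deduplicate _≟_ (map g E)

  image-unique : ∀ E → Unique (image E)
  image-unique E = DecUniqueP.deduplicate-! _≟_ (map g E)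

  ∈-image : ∀ {E p} → p ∈ E → g p ∈ image E
  ∈-image p∈E = ∈P.∈-deduplicate⁺ _≟_ (∈P.∈-map⁺ g p∈E)

  fibreSize-filter : ∀ E b → fibreSize E b ≡ length (filter (λ x → g x ≟ b) E)
  fibreSize-filter [] b = refl
  fibreSize-filter (x ∷ E) b with g x ≟ b
  ... | yes _ = cong suc (fibreSize-filter E b)
  ... | no _ = fibreSize-filter E b

  fibreSize-mono : ∀ {P : A → Set} (P? : ∀ x → Dec (P x)) E b → fibreSize (filter P? E) b ≤ℕ fibreSize E b
  fibreSize-mono P? [] b = z≤n
  fibreSize-mono P? (x ∷ E) b with P? x
  ... | yes _ = ℕP.+-monoʳ-≤ (indicator (g x ≟ b)) (fibreSize-mono P? E b)
  ... | no _ = ℕP.≤-trans (fibreSize-mono P? E b) (ℕP.m≤n+m _ _)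

  -- A fibre of size k contributes k² to the energy, and k² ≥ 4k - 4.
  4k≤k²+4 : ∀ k → 4 *ℕ k ≤ℕ k *ℕ k +ℕ 4
  4k≤k²+4 0 = z≤n
  4k≤k²+4 1 = ℕP.n≤1+n 4
  4k≤k²+4 2 = ℕP.≤-refl
  4k≤k²+4 3 = ℕP.n≤1+n 12
  4k≤k²+4 (suc (suc (suc (suc j)))) = ℕP.≤-trans (ℕP.*-monoˡ-≤ (4 +ℕ j) (ℕP.m≤m+n 4 j)) (ℕP.m≤m+n _ 4)

  energy-lower : ∀ (V : List B) (E : List A) → All (λ p → g p ∈ V) E →
    4 *ℕ length E ≤ℕ energy E +ℕ 4 *ℕ length V
  energy-lower [] [] [] = z≤n
  energy-lower [] (x ∷ E) (() ∷ _)
  energy-lower (c ∷ V) E E⊆cV = begin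
    4 *ℕ length E                                    ≡⟨ cong (4 *ℕ_) split-length ⟩
    4 *ℕ (length Ec +ℕ length Er)                    ≡⟨ ℕP.*-distribˡ-+ 4 (length Ec) (length Er) ⟩
    4 *ℕ length Ec +ℕ 4 *ℕ length Er                 ≤⟨ ℕP.+-mono-≤ (4k≤k²+4 (length Ec)) (energy-lower V Er Er⊆V) ⟩
    (length Ec *ℕ length Ec +ℕ 4) +ℕ (energy Er +ℕ 4 *ℕ length V)
                                                     ≡⟨ regroup (length Ec *ℕ length Ec) (energy Er) (length V) ⟩
    (length Ec *ℕ length Ec +ℕ energy Er) +ℕ 4 *ℕ length (c ∷ V)
                                                     ≤⟨ ℕP.+-monoˡ-≤ _ split-energy ⟩
    energy E +ℕ 4 *ℕ length (c ∷ V)                  ∎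
    where
    open ℕP.≤-Reasoning
    onC : ∀ x → Dec (g x ≡ c)
    onC x = g x ≟ c
    offC : ∀ x → Dec (¬ g x ≡ c)
    offC x = ¬? (g x ≟ c)
    Ec = filter onC E
    Er = filter offC E
    Er⊆V : All (λ p → g p ∈ V) Er
    Er⊆V = All.zipWith (λ { (gp≢c , here gp≡c) → ⊥-elim (gp≢c gp≡c) ; (_ , there gp∈V) → gp∈V })
                       (AllP.all-filter offC E , AllP.filter⁺ offC E⊆cV)
    split-length : length E ≡ length Ec +ℕ length Er
    split-length = trans (sym (∑-one E)) (trans (∑-filter onC (λ _ → 1) E) (cong₂ _+ℕ_ (∑-one Ec) (∑-one Er)))
    -- each point of the fibre over c sees the whole fibre
    fibre-c : ∑[ p ∈ Ec ] fibreSize E (g p) ≡ length Ec *ℕ length Ec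
    fibre-c = ∑-const (length Ec) (λ p → fibreSize E (g p))
                (All.map (λ gp≡c → trans (cong (fibreSize E) gp≡c) (fibreSize-filter E c)) (AllP.all-filter onC E))
    fibre-rest : energy Er ≤ℕ ∑[ p ∈ Er ] fibreSize E (g p)
    fibre-rest = ∑-mono {xs = Er} (All.tabulate (λ {p} _ → fibreSize-mono offC E (g p)))
    split-energy : length Ec *ℕ length Ec +ℕ energy Er ≤ℕ energy E
    split-energy = ℕP.≤-trans (ℕP.+-monoʳ-≤ _ fibre-rest)
      (ℕP.≤-reflexive (sym (trans (∑-filter onC (λ p → fibreSize E (g p)) E) (cong (_+ℕ ∑[ p ∈ Er ] fibreSize E (g p)) fibre-c))))
    regroup : ∀ a b v → (a +ℕ 4) +ℕ (b +ℕ 4 *ℕ v) ≡ (a +ℕ b) +ℕ 4 *ℕ suc v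
    regroup = solve-∀

  Collision : List A → Set
  Collision E = Σ A (λ p → Σ A (λ p′ → p ∈ E × p′ ∈ E × ¬ p ≡ p′ × g p ≡ g p′))

  collision-or-injective : ∀ E → Unique E → Collision E ⊎ Unique (map g E)
  collision-or-injective [] [] = inj₂ []
  collision-or-injective (e ∷ E) (e∉E ∷ u) with Any.any? (λ x → g e ≟ g x) E
  ... | yes some = let x , x∈E , ge≡gx = find some in
    inj₁ (e , x , here refl , there x∈E , All.lookup e∉E x∈E , ge≡gx)
  ... | no none with collision-or-injective E u
  ...   | inj₁ (p , p′ , p∈E , p′∈E , p≢p′ , same) = inj₁ (p , p′ , there p∈E , there p′∈E , p≢p′ , same)
  ...   | inj₂ injective = inj₂ (AllP.map⁺ (AllP.¬Any⇒All¬ E none) ∷ injective)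

  record Representatives (E : List A) (a : B) : Set where
    field
      reps : List A
      reps⊆E : All (_∈ E) reps
      avoid : All (λ x → ¬ g x ≡ a) reps
      distinct : Unique (map g reps)
      enough : length (image E) ≤ℕ suc (length reps)

  representatives : ∀ E a → Representatives E a
  representatives E a = record
    { reps = xs ; reps⊆E = xs⊆E
    ; avoid = AllP.map⁻ (subst (All (λ v → ¬ v ≡ a)) (sym gxs≡V′) (AllP.all-filter off-a (image E)))
    ; distinct = subst Unique (sym gxs≡V′) (UniqueP.filter⁺ off-a (image-unique E))
    ; enough = subst (λ n → length (image E) ≤ℕ suc n) (sym same-length) (remove-one _≟_ a (image E) (image-unique E))
    }
    where
    off-a : ∀ v → Dec (¬ v ≡ a)
    off-a v = ¬? (v ≟ a)
    V′ = filter off-a (image E)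
    V′⊆gE : All (_∈ map g E) V′
    V′⊆gE = All.tabulate (λ v∈V′ → ∈P.∈-deduplicate⁻ _≟_ (map g E) (proj₁ (∈P.∈-filter⁻ off-a v∈V′)))
    chosen = preimages g E V′ V′⊆gE
    xs = proj₁ chosen
    xs⊆E = proj₁ (proj₂ chosen)
    gxs≡V′ : map g xs ≡ V′
    gxs≡V′ = proj₂ (proj₂ chosen)
    same-length : length xs ≡ length V′
    same-length = trans (sym (ListP.length-map g xs)) (cong length gxs≡V′)

-- A family of maps level t (t : T) such that two distinct points agree
-- under at most one member of the family, like the projections of the plane
-- onto the parallel classes of lines.
module SeparatingFamily {T A B : Set} (_≟_ : DecidableEquality B) (_≟A_ : DecidableEquality A)
  (level : T → A → B)
  (separating : ∀ {t s x y} → ¬ t ≡ s → ¬ x ≡ y → level t x ≡ level t y → level s x ≡ level s y → ⊥) where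
  open Counting
  open Fibres {A} _≟_ using (energy; image; ∈-image; energy-lower)

  agreements : List T → A → A → ℕ
  agreements ts p x = ∑[ t ∈ ts ] indicator (level t x ≟ level t p)

  agreements≤length : ∀ ts p x → agreements ts p x ≤ℕ length ts
  agreements≤length [] p x = z≤n
  agreements≤length (t ∷ ts) p x = ℕP.+-mono-≤ (indicator≤1 (level t x ≟ level t p)) (agreements≤length ts p x)

  agreements≤1 : ∀ ts p x → Unique ts → ¬ p ≡ x → agreements ts p x ≤ℕ 1
  agreements≤1 [] p x _ _ = z≤n
  agreements≤1 (t ∷ ts) p x (t∉ts ∷ u) p≢x with level t x ≟ level t p
  ... | yes agree = ℕP.≤-reflexive (cong suc (∑-zero _ (All.map no-other t∉ts)))
    where no-other : ∀ {s} → ¬ t ≡ s → indicator (level s x ≟ level s p) ≡ 0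
          no-other {s} t≢s with level s x ≟ level s p
          ... | yes agree′ = ⊥-elim (separating t≢s p≢x (sym agree) (sym agree′))
          ... | no _ = refl
  ... | no _ = agreements≤1 ts p x u p≢x

  -- p agrees with itself under every member and with any other point under at most one.
  agreements-with : ∀ ts p E → Unique ts → Unique E → ∑ E (agreements ts p) ≤ℕ length ts +ℕ length E
  agreements-with ts p [] _ _ = z≤n
  agreements-with ts p (e ∷ E) uts (e∉E ∷ uE) with p ≟A e
  ... | yes refl = begin
    agreements ts p p +ℕ ∑ E (agreements ts p)  ≤⟨ ℕP.+-mono-≤ (agreements≤length ts p p) others ⟩
    length ts +ℕ length E                       ≤⟨ ℕP.+-monoʳ-≤ (length ts) (ℕP.n≤1+n _) ⟩
    length ts +ℕ suc (length E)                 ∎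
    where open ℕP.≤-Reasoning
          others : ∑ E (agreements ts p) ≤ℕ length E
          others = ℕP.≤-trans (∑-mono {g = λ _ → 1} (All.map (λ p≢x → agreements≤1 ts p _ uts p≢x) e∉E))
                              (ℕP.≤-reflexive (∑-one E))
  ... | no p≢e = begin
    agreements ts p e +ℕ ∑ E (agreements ts p)  ≤⟨ ℕP.+-mono-≤ (agreements≤1 ts p e uts p≢e) (agreements-with ts p E uts uE) ⟩
    suc (length ts +ℕ length E)                 ≡⟨ sym (ℕP.+-suc (length ts) (length E)) ⟩
    length ts +ℕ suc (length E)                 ∎
    where open ℕP.≤-Reasoning

  energy-total : ∀ ts E → Unique ts → Unique E →
    ∑[ t ∈ ts ] energy (level t) E ≤ℕ length E *ℕ (length ts +ℕ length E)
  energy-total ts E uts uE = begin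
    ∑[ t ∈ ts ] ∑[ p ∈ E ] ∑[ x ∈ E ] δ t p x   ≡⟨ ∑-swap (λ t p → ∑[ x ∈ E ] δ t p x) ts E ⟩
    ∑[ p ∈ E ] ∑[ t ∈ ts ] ∑[ x ∈ E ] δ t p x   ≡⟨ ∑-cong E (λ p → ∑-swap (λ t x → δ t p x) ts E) ⟩
    ∑[ p ∈ E ] ∑ E (agreements ts p)            ≤⟨ ∑-mono {xs = E} (All.tabulate (λ {p} _ → agreements-with ts p E uts uE)) ⟩
    ∑[ p ∈ E ] (length ts +ℕ length E)          ≡⟨ ∑-const _ (λ _ → length ts +ℕ length E) {E} (All.tabulate (λ _ → refl)) ⟩
    length E *ℕ (length ts +ℕ length E)         ∎
    where
    open ℕP.≤-Reasoning
    δ : T → A → A → ℕ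
    δ t p x = indicator (level t x ≟ level t p)

  -- If every member of ts had fewer than K / 2 values on E, the energy
  -- lower bound for each member would contradict `energy-total`.
  someLargeImage : ∀ K ts E → Unique ts → Unique E →
    length E *ℕ (length ts +ℕ length E) +ℕ length ts *ℕ (2 *ℕ (K ∸ 1)) <ℕ length ts *ℕ (4 *ℕ length E) →
    Σ T (λ t → K ≤ℕ 2 *ℕ length (image (level t) E))
  someLargeImage K ts E uts uE excess
    with Any.any? (λ t → K ℕP.≤? 2 *ℕ length (image (level t) E)) ts
  ... | yes some = proj₁ (Any.satisfied some) , proj₂ (Any.satisfied some)
  ... | no none = ⊥-elim (ℕP.<⇒≱ excess (begin
    length ts *ℕ (4 *ℕ length E)                      ≡⟨ sym (∑-const _ (λ _ → 4 *ℕ length E) {ts} (All.tabulate (λ _ → refl))) ⟩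
    ∑[ t ∈ ts ] (4 *ℕ length E)                        ≤⟨ ∑-mono {xs = ts} (All.map small⇒bound (AllP.¬Any⇒All¬ ts none)) ⟩
    ∑[ t ∈ ts ] (energy (level t) E +ℕ 2 *ℕ (K ∸ 1))  ≡⟨ ∑-+ (λ t → energy (level t) E) (λ _ → 2 *ℕ (K ∸ 1)) ts ⟩
    ∑[ t ∈ ts ] energy (level t) E +ℕ ∑[ t ∈ ts ] (2 *ℕ (K ∸ 1))
        ≤⟨ ℕP.+-mono-≤ (energy-total ts E uts uE)
                       (ℕP.≤-reflexive (∑-const _ (λ _ → 2 *ℕ (K ∸ 1)) {ts} (All.tabulate (λ _ → refl)))) ⟩
    length E *ℕ (length ts +ℕ length E) +ℕ length ts *ℕ (2 *ℕ (K ∸ 1)) ∎))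
    where
    open ℕP.≤-Reasoning
    small⇒bound : ∀ {t} → ¬ K ≤ℕ 2 *ℕ length (image (level t) E) → 4 *ℕ length E ≤ℕ energy (level t) E +ℕ 2 *ℕ (K ∸ 1)
    small⇒bound {t} small = ℕP.≤-trans
      (energy-lower (level t) (image (level t) E) E (All.tabulate (∈-image (level t))))
      (ℕP.+-monoʳ-≤ (energy (level t) E) (begin
        4 *ℕ v        ≡⟨ ℕP.*-assoc 2 2 v ⟩
        2 *ℕ (2 *ℕ v) ≤⟨ ℕP.*-monoʳ-≤ 2 (ℕP.<⇒≤pred (ℕP.≰⇒> small)) ⟩
        2 *ℕ (K ∸ 1)  ∎))
      where v = length (image (level t) E)

module Plane {q : ℕ} (F : FiniteField q) where
  open FiniteField F
  open IntegerRingSolver isCommutativeRing using (commutativeRing; solve; _:=_; _:+_; _:-_; _:*_; con)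
  open CommutativeRing commutativeRing using (+-identityˡ; *-identityˡ; *-comm; *-assoc; zeroʳ)
  open ≡-Reasoning

  sub≡0⇒≡ : ∀ {a b} → a - b ≡ 0# → a ≡ b
  sub≡0⇒≡ {a} {b} a-b≡0 = begin
    a             ≡⟨ solve 2 (λ a b → a := (a :- b) :+ b) refl a b ⟩
    (a - b) + b   ≡⟨ cong (_+ b) a-b≡0 ⟩
    0# + b        ≡⟨ +-identityˡ b ⟩
    b             ∎

  +-cancelʳ : ∀ {a b} c → a + c ≡ b + c → a ≡ b
  +-cancelʳ {a} {b} c a+c≡b+c = sub≡0⇒≡ (begin
    a - b                   ≡⟨ solve 3 (λ a b c → a :- b := (a :+ c) :- (b :+ c)) refl a b c ⟩
    (a + c) - (b + c)       ≡⟨ cong (_- (b + c)) a+c≡b+c ⟩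
    (b + c) - (b + c)       ≡⟨ solve 1 (λ x → x :- x := con (ℤ.+ 0)) refl (b + c) ⟩
    0#                      ∎)

  zero-product : ∀ {a b} → ¬ a ≡ 0# → a * b ≡ 0# → b ≡ 0#
  zero-product {a} {b} a≢0 ab≡0 = begin
    b                 ≡⟨ sym (*-identityˡ b) ⟩
    1# * b            ≡⟨ cong (_* b) (sym (trans (*-comm _ _) (inverseʳ a a≢0))) ⟩
    (a ⁻¹ * a) * b    ≡⟨ *-assoc _ _ _ ⟩
    a ⁻¹ * (a * b)    ≡⟨ cong (a ⁻¹ *_) ab≡0 ⟩
    a ⁻¹ * 0#         ≡⟨ zeroʳ _ ⟩
    0#                ∎

  *-cancelˡ : ∀ {c u v} → ¬ c ≡ 0# → c * u ≡ c * v → u ≡ v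
  *-cancelˡ {c} {u} {v} c≢0 cu≡cv = sub≡0⇒≡ (zero-product c≢0 (begin
    c * (u - v)         ≡⟨ solve 3 (λ c u v → c :* (u :- v) := c :* u :- c :* v) refl c u v ⟩
    c * u - c * v       ≡⟨ cong (_- c * v) cu≡cv ⟩
    c * v - c * v       ≡⟨ solve 1 (λ x → x :- x := con (ℤ.+ 0)) refl (c * v) ⟩
    0#                  ∎))

  elements : List Carrier
  elements = map (Bijection.to enumeration) (allFin q)

  elements-unique : Unique elements
  elements-unique = UniqueP.map⁺ (Bijection.injective enumeration) (UniqueP.allFin⁺ q)

  elements-length : length elements ≡ q
  elements-length = trans (ListP.length-map _ (allFin q)) (ListP.length-tabulate (λ i → i))

  ∈-elements : ∀ c → c ∈ elements
  ∈-elements c with Bijection.surjective enumeration c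
  ... | i , to-i≡c = subst (_∈ elements) (to-i≡c refl) (∈P.∈-map⁺ _ (∈P.∈-allFin i))

  unique-length≤q : ∀ V → Unique V → length V ≤ℕ q
  unique-length≤q V u = subst (length V ≤ℕ_) elements-length
    (Counting.unique-length-≤ _≟_ V elements u (All.tabulate (λ {c} _ → ∈-elements c)))

  -- The q + 1 parallel classes of lines: `nothing` is the class of vertical
  -- lines x₁ = c, and `just m` the class of lines x₂ - m x₁ = c.
  Direction : Set
  Direction = Maybe Carrier

  level : Direction → Point → Carrier
  level nothing (x₁ , x₂) = x₁
  level (just m) (x₁ , x₂) = x₂ - m * x₁

  directions : List Direction
  directions = nothing ∷ map just elements

  directions-unique : Unique directions
  directions-unique = AllP.map⁺ (All.tabulate (λ _ ())) ∷ UniqueP.map⁺ (λ { refl → refl }) elements-unique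

  directions-length : length directions ≡ suc q
  directions-length = cong suc (trans (ListP.length-map just elements) elements-length)

  separating : ∀ {t s x y} → ¬ t ≡ s → ¬ x ≡ y → level t x ≡ level t y → level s x ≡ level s y → ⊥
  separating {nothing} {nothing} t≢s _ _ _ = t≢s refl
  separating {nothing} {just m} {a₁ , a₂} {.a₁ , b₂} _ x≢y refl same-s = x≢y (cong (a₁ ,_) (+-cancelʳ (- (m * a₁)) same-s))
  separating {just m} {nothing} {a₁ , a₂} {.a₁ , b₂} _ x≢y same-t refl = x≢y (cong (a₁ ,_) (+-cancelʳ (- (m * a₁)) same-t))
  separating {just m} {just m′} {a₁ , a₂} {b₁ , b₂} t≢s x≢y same-t same-s = x≢y (cong₂ _,_ a₁≡b₁ a₂≡b₂)
    where
    m′-m≢0 : ¬ m′ - m ≡ 0#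
    m′-m≢0 e = t≢s (cong just (sym (sub≡0⇒≡ e)))
    a₁≡b₁ : a₁ ≡ b₁
    a₁≡b₁ = *-cancelˡ m′-m≢0 (begin
      (m′ - m) * a₁                       ≡⟨ solve 4 (λ m m′ a₁ a₂ → (m′ :- m) :* a₁ := (a₂ :- m :* a₁) :- (a₂ :- m′ :* a₁)) refl m m′ a₁ a₂ ⟩
      (a₂ - m * a₁) - (a₂ - m′ * a₁)      ≡⟨ cong₂ _-_ same-t same-s ⟩
      (b₂ - m * b₁) - (b₂ - m′ * b₁)      ≡⟨ solve 4 (λ m m′ b₁ b₂ → (b₂ :- m :* b₁) :- (b₂ :- m′ :* b₁) := (m′ :- m) :* b₁) refl m m′ b₁ b₂ ⟩
      (m′ - m) * b₁                       ∎)
    a₂≡b₂ : a₂ ≡ b₂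
    a₂≡b₂ = +-cancelʳ (- (m * a₁)) (trans same-t (cong (λ z → b₂ - m * z) (sym a₁≡b₁)))

  areaPinned : ∀ p p′ x → det (p -ₚ x) (p′ -ₚ x) ≡ det (p′ -ₚ p) (x -ₚ p)
  areaPinned (a₁ , a₂) (b₁ , b₂) (x₁ , x₂) =
    solve 6 (λ a₁ a₂ b₁ b₂ x₁ x₂ → (a₁ :- x₁) :* (b₂ :- x₂) :- (a₂ :- x₂) :* (b₁ :- x₁)
                                  := (b₁ :- a₁) :* (x₂ :- a₂) :- (b₂ :- a₂) :* (x₁ :- a₁)) refl a₁ a₂ b₁ b₂ x₁ x₂

  areaAlongLine : ∀ t p p′ → ¬ p ≡ p′ → level t p ≡ level t p′ →
    Σ Carrier (λ c → ¬ c ≡ 0# × (∀ x → det (p′ -ₚ p) (x -ₚ p) ≡ c * (level t x - level t p)))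
  areaAlongLine nothing (a₁ , a₂) (.a₁ , b₂) p≢p′ refl = a₂ - b₂ , c≢0 , area
    where
    c≢0 : ¬ a₂ - b₂ ≡ 0#
    c≢0 e = p≢p′ (cong (a₁ ,_) (sub≡0⇒≡ e))
    area : ∀ x → det ((a₁ , b₂) -ₚ (a₁ , a₂)) (x -ₚ (a₁ , a₂)) ≡ (a₂ - b₂) * (level nothing x - a₁)
    area (x₁ , x₂) = solve 5 (λ a₁ a₂ b₂ x₁ x₂ → (a₁ :- a₁) :* (x₂ :- a₂) :- (b₂ :- a₂) :* (x₁ :- a₁)
                                                := (a₂ :- b₂) :* (x₁ :- a₁)) refl a₁ a₂ b₂ x₁ x₂
  areaAlongLine (just m) (a₁ , a₂) (b₁ , b₂) p≢p′ same = b₁ - a₁ , c≢0 , area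
    where
    b₂≡ : b₂ ≡ (a₂ - m * a₁) + m * b₁
    b₂≡ = begin
      b₂                       ≡⟨ solve 3 (λ b₂ m b₁ → b₂ := (b₂ :- m :* b₁) :+ m :* b₁) refl b₂ m b₁ ⟩
      (b₂ - m * b₁) + m * b₁   ≡⟨ cong (_+ m * b₁) (sym same) ⟩
      (a₂ - m * a₁) + m * b₁   ∎
    c≢0 : ¬ b₁ - a₁ ≡ 0#
    c≢0 e = p≢p′ (cong₂ _,_ (sym b₁≡a₁) (sym (begin
      b₂                       ≡⟨ b₂≡ ⟩
      (a₂ - m * a₁) + m * b₁   ≡⟨ cong (λ z → (a₂ - m * a₁) + m * z) b₁≡a₁ ⟩
      (a₂ - m * a₁) + m * a₁   ≡⟨ solve 3 (λ a₂ m a₁ → (a₂ :- m :* a₁) :+ m :* a₁ := a₂) refl a₂ m a₁ ⟩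
      a₂                       ∎)))
      where b₁≡a₁ = sub≡0⇒≡ e
    area : ∀ x → det ((b₁ , b₂) -ₚ (a₁ , a₂)) (x -ₚ (a₁ , a₂)) ≡ (b₁ - a₁) * (level (just m) x - (a₂ - m * a₁))
    area (x₁ , x₂) rewrite b₂≡ =
      solve 6 (λ a₁ a₂ b₁ m x₁ x₂ → (b₁ :- a₁) :* (x₂ :- a₂) :- (((a₂ :- m :* a₁) :+ m :* b₁) :- a₂) :* (x₁ :- a₁)
                                   := (b₁ :- a₁) :* ((x₂ :- m :* x₁) :- (a₂ :- m :* a₁))) refl a₁ a₂ b₁ m x₁ x₂

  open Fibres {Point} _≟_ using (image; collision-or-injective; Representatives; representatives)

  record SameBaseAreas (K : ℕ) (E : List Point) : Set where
    field
      p p′ : Point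
      p∈E : p ∈ E
      p′∈E : p′ ∈ E
      p≢p′ : ¬ p ≡ p′
      apexes : List Point
      apexes⊆E : All (_∈ E) apexes
      many : K ≤ℕ 2 *ℕ suc (length apexes)
      nonzero : All (λ x → ¬ det (p -ₚ x) (p′ -ₚ x) ≡ 0#) apexes
      distinct : Unique (map (λ x → det (p -ₚ x) (p′ -ₚ x)) apexes)

  -- If more than q points of E meet at least K / 2 lines of direction t, two
  -- of them share such a line, and one point on each other line is an apex.
  sameBaseAreas : ∀ K E → Unique E → q <ℕ length E → (t : Direction) →
    K ≤ℕ 2 *ℕ length (image (level t) E) → SameBaseAreas K E
  sameBaseAreas K E uE q<|E| t large with collision-or-injective (level t) E uE
  ... | inj₂ injective =
    ⊥-elim (ℕP.<⇒≱ q<|E| (subst (_≤ℕ q) (ListP.length-map (level t) E) (unique-length≤q _ injective)))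
  ... | inj₁ (p , p′ , p∈E , p′∈E , p≢p′ , same) = record
    { p = p ; p′ = p′ ; p∈E = p∈E ; p′∈E = p′∈E ; p≢p′ = p≢p′
    ; apexes = R.reps ; apexes⊆E = R.reps⊆E
    ; many = ℕP.≤-trans large (ℕP.*-monoʳ-≤ 2 R.enough)
    ; nonzero = All.map (λ {x} off-line area≡0 → off-line (sub≡0⇒≡ (zero-product c≢0 (trans (sym (area′ x)) area≡0)))) R.avoid
    ; distinct = subst Unique (sym (trans (ListP.map-cong area′ R.reps) (ListP.map-∘ R.reps)))
                       (UniqueP.map⁺ scaled-injective R.distinct)
    }
    where
    a = level t p
    line = areaAlongLine t p p′ p≢p′ same
    c = proj₁ line
    c≢0 = proj₁ (proj₂ line)
    module R = Representatives (level t) (representatives (level t) E a)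
    scaled : Carrier → Carrier
    scaled v = c * (v - a)
    scaled-injective : ∀ {u v} → scaled u ≡ scaled v → u ≡ v
    scaled-injective e = +-cancelʳ (- a) (*-cancelˡ c≢0 e)
    area′ : ∀ x → det (p -ₚ x) (p′ -ₚ x) ≡ scaled (level t x)
    area′ x = trans (areaPinned p p′ x) (proj₂ (proj₂ line) x)

  sameBaseAreas-⊆ : ∀ {K E E′} → All (_∈ E) E′ → SameBaseAreas K E′ → SameBaseAreas K E
  sameBaseAreas-⊆ E′⊆E S = record
    { p = p ; p′ = p′ ; p∈E = All.lookup E′⊆E p∈E ; p′∈E = All.lookup E′⊆E p′∈E ; p≢p′ = p≢p′
    ; apexes = apexes ; apexes⊆E = All.map (All.lookup E′⊆E) apexes⊆E
    ; many = many ; nonzero = nonzero ; distinct = distinct }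
    where open SameBaseAreas S

  ∈-nonzeroValues : ∀ {v vs} → v ∈ vs → ¬ v ≡ 0# → v ∈ nonzeroValues vs
  ∈-nonzeroValues v∈vs v≢0 = ∈P.∈-deduplicate⁺ _≟_ (∈P.∈-filter⁺ (λ w → ¬? (w ≟ 0#)) v∈vs v≢0)

  ∈-V₂ : ∀ {E x₁ x₂ x₃} → x₁ ∈ E → x₂ ∈ E → x₃ ∈ E → ¬ det (x₁ -ₚ x₃) (x₂ -ₚ x₃) ≡ 0# →
    det (x₁ -ₚ x₃) (x₂ -ₚ x₃) ∈ V₂ E
  ∈-V₂ {E} {x₁} {x₂} x₁∈E x₂∈E x₃∈E = ∈-nonzeroValues
    (∈P.∈-concatMap⁺ (λ y₁ → concatMap (λ y₂ → map (λ y₃ → det (y₁ -ₚ y₃) (y₂ -ₚ y₃)) E) E) (Any.map (λ { refl →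
      ∈P.∈-concatMap⁺ (λ y₂ → map (λ y₃ → det (x₁ -ₚ y₃) (y₂ -ₚ y₃)) E) (Any.map (λ { refl →
        ∈P.∈-map⁺ (λ y₃ → det (x₁ -ₚ y₃) (x₂ -ₚ y₃)) x₃∈E }) x₂∈E) }) x₁∈E))

  ∈-V₂pin : ∀ {E z x₁ x₂} → x₁ ∈ E → x₂ ∈ E → ¬ det (x₁ -ₚ z) (x₂ -ₚ z) ≡ 0# →
    det (x₁ -ₚ z) (x₂ -ₚ z) ∈ V₂pin z E
  ∈-V₂pin {E} {z} {x₁} x₁∈E x₂∈E = ∈-nonzeroValues
    (∈P.∈-concatMap⁺ (λ y₁ → map (λ y₂ → det (y₁ -ₚ z) (y₂ -ₚ z)) E) (Any.map (λ { refl →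
      ∈P.∈-map⁺ (λ y₂ → det (x₁ -ₚ z) (y₂ -ₚ z)) x₂∈E }) x₁∈E))

  apexes≤V₂ : ∀ {K E} (S : SameBaseAreas K E) → length (SameBaseAreas.apexes S) ≤ℕ length (V₂ E)
  apexes≤V₂ {E = E} S = subst (_≤ℕ length (V₂ E)) (ListP.length-map _ apexes)
    (Counting.unique-length-≤ _≟_ _ (V₂ E) distinct
      (AllP.map⁺ (All.zipWith (λ (x∈E , area≢0) → ∈-V₂ p∈E p′∈E x∈E area≢0) (apexes⊆E , nonzero))))
    where open SameBaseAreas S

  apexes≤V₂pin : ∀ {K E} (S : SameBaseAreas K E) →
    length (SameBaseAreas.apexes S) ≤ℕ length (V₂pin (SameBaseAreas.p S) E)
  apexes≤V₂pin {E = E} S = subst (_≤ℕ length (V₂pin p E)) (ListP.length-map _ apexes)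
    (Counting.unique-length-≤ _≟_ _ (V₂pin p E) distinct
      (AllP.map⁺ (All.zipWith (λ {x} (x∈E , area≢0) →
        subst (_∈ V₂pin p E) (sym (areaPinned p p′ x))
              (∈-V₂pin p′∈E x∈E (λ e → area≢0 (trans (areaPinned p p′ x) e)))) (apexes⊆E , nonzero))))
    where open SameBaseAreas S

  open SeparatingFamily _≟_ _≟ₚ_ level separating using (someLargeImage)

  sameBaseAreasIn : ∀ K n E → Unique E → q <ℕ n → n ≤ℕ length E →
    n *ℕ (suc q +ℕ n) +ℕ suc q *ℕ (2 *ℕ (K ∸ 1)) <ℕ suc q *ℕ (4 *ℕ n) →
    SameBaseAreas K E
  sameBaseAreasIn K n E uE q<n n≤|E| excess = sameBaseAreas-⊆ E′⊆E
    (sameBaseAreas K E′ uE′ (subst (q <ℕ_) (sym |E′|≡n) q<n) (proj₁ large) (proj₂ large))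
    where
    sub = Counting.subsetOfSize n E uE n≤|E|
    E′ = proj₁ sub
    uE′ = proj₁ (proj₂ sub)
    |E′|≡n = proj₁ (proj₂ (proj₂ sub))
    E′⊆E = proj₂ (proj₂ (proj₂ sub))
    large = someLargeImage K directions E′ directions-unique uE′
      (subst₂ (λ d m → m *ℕ (d +ℕ m) +ℕ d *ℕ (2 *ℕ (K ∸ 1)) <ℕ d *ℕ (4 *ℕ m))
              (sym directions-length) (sym |E′|≡n) excess)

<-by-gap : ∀ m k {n} → m +ℕ suc k ≡ n → m <ℕ n
<-by-gap m k eq = subst (m <ℕ_) eq (ℕP.m<m+n m (s≤s z≤n))

-- The arithmetic of the double count: n = q + 1 points, K = q + 1 ...
excess-i : ∀ q → suc q *ℕ (suc q +ℕ suc q) +ℕ suc q *ℕ (2 *ℕ (suc q ∸ 1)) <ℕ suc q *ℕ (4 *ℕ suc q)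
excess-i q = <-by-gap _ (suc (2 *ℕ q)) (identity q)
  where identity : ∀ q → (suc q *ℕ (suc q +ℕ suc q) +ℕ suc q *ℕ (2 *ℕ q)) +ℕ suc (suc (2 *ℕ q)) ≡ suc q *ℕ (4 *ℕ suc q)
        identity = solve-∀

-- ... and n = q + 4 points, K = q + 3, which needs q ≥ 9.
excess-ii : ∀ q → 9 ≤ℕ q → (4 +ℕ q) *ℕ (suc q +ℕ (4 +ℕ q)) +ℕ suc q *ℕ (2 *ℕ (3 +ℕ q ∸ 1)) <ℕ suc q *ℕ (4 *ℕ (4 +ℕ q))
excess-ii q 9≤q = subst (λ q → (4 +ℕ q) *ℕ (suc q +ℕ (4 +ℕ q)) +ℕ suc q *ℕ (2 *ℕ (2 +ℕ q)) <ℕ suc q *ℕ (4 *ℕ (4 +ℕ q)))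
    (ℕP.m+[n∸m]≡n 9≤q) (<-by-gap _ (q ∸ 9) (identity (q ∸ 9)))
  where identity : ∀ r → ((4 +ℕ (9 +ℕ r)) *ℕ (suc (9 +ℕ r) +ℕ (4 +ℕ (9 +ℕ r))) +ℕ suc (9 +ℕ r) *ℕ (2 *ℕ (2 +ℕ (9 +ℕ r)))) +ℕ suc r
                       ≡ suc (9 +ℕ r) *ℕ (4 *ℕ (4 +ℕ (9 +ℕ r)))
        identity = solve-∀

exponent-bound : ∀ q N → 2 ≤ℕ q → q ^ (64 *ℕ q) ≤ℕ 2 ^ N → 64 *ℕ q ≤ℕ N
exponent-bound q N 2≤q q^64q≤2^N = ℕP.≮⇒≥ (λ N<64q → ℕP.<⇒≱
  (ℕP.^-monoʳ-< 2 (s≤s (s≤s z≤n)) N<64q)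
  (ℕP.≤-trans (ℕP.^-monoˡ-≤ (64 *ℕ q) 2≤q) q^64q≤2^N))

enough-points : ∀ q N → 9 ≤ℕ q → q ^ (64 *ℕ q) ≤ℕ 2 ^ N → 4 +ℕ q ≤ℕ N
enough-points (suc k) N 9≤q h = ℕP.≤-trans (subst (4 +ℕ suc k ≤ℕ_) (identity k) (ℕP.m≤m+n _ _))
                                          (exponent-bound (suc k) N (ℕP.≤-trans (s≤s (s≤s z≤n)) 9≤q) h)
  where identity : ∀ k → (4 +ℕ suc k) +ℕ (59 +ℕ 63 *ℕ k) ≡ 64 *ℕ suc k
        identity = solve-∀

bound-i : ∀ q L → suc q ≤ℕ 2 *ℕ suc L → q ∸ 1 ≤ℕ 2 *ℕ L
bound-i q L h = ℕP.∸-monoˡ-≤ 1 (ℕP.≤-pred (subst (suc q ≤ℕ_) (ℕP.*-suc 2 L) h))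

bound-ii : ∀ q L → 3 +ℕ q ≤ℕ 2 *ℕ suc L → q <ℕ 2 *ℕ L
bound-ii q L h = ℕP.≤-pred (ℕP.≤-pred (subst (3 +ℕ q ≤ℕ_) (ℕP.*-suc 2 L) h))

theorem1p1 : ((q : ℕ) (F : FiniteField q)
    (E : List (FiniteField.Point F)) → Unique E → q <ℕ length E →
    (q ∸ 1 ≤ℕ 2 *ℕ length (FiniteField.V₂ F E))
    × Σ (FiniteField.Point F) (λ e₁ → Σ (FiniteField.Point F) (λ e₂ → Σ (List (FiniteField.Point F)) (λ xs →
    e₁ ∈ E × e₂ ∈ E × ¬ (e₁ ≡ e₂) × All (_∈ E) xs
    × q ∸ 1 ≤ℕ 2 *ℕ length xs
    × All (λ x → ¬ (FiniteField.det F (FiniteField._-ₚ_ F e₁ x) (FiniteField._-ₚ_ F e₂ x) ≡ FiniteField.0# F)) xs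
    × Unique (map (λ x → FiniteField.det F (FiniteField._-ₚ_ F e₁ x) (FiniteField._-ₚ_ F e₂ x)) xs)))))
    × ∃ (λ (C : ℕ) → (q : ℕ) (F : FiniteField q)
    (E : List (FiniteField.Point F)) → Unique E → C ≤ℕ q →
    q ^ (64 *ℕ q) ≤ℕ 2 ^ length E →
    Σ (FiniteField.Point F) (λ z → z ∈ E × q <ℕ 2 *ℕ length (FiniteField.V₂pin F z E)))
theorem1p1 =
  (λ q F E uE q<|E| →
    let open Plane F
        S = sameBaseAreasIn (suc q) (suc q) E uE ℕP.≤-refl q<|E| (excess-i q)
        open SameBaseAreas S
        enough = bound-i q (length apexes) many
    in ℕP.≤-trans enough (ℕP.*-monoʳ-≤ 2 (apexes≤V₂ S))
     , (p , p′ , apexes , p∈E , p′∈E , p≢p′ , apexes⊆E , enough , nonzero , distinct)) ,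
  (9 , λ q F E uE 9≤q q^64q≤2^|E| →
    let open Plane F
        S = sameBaseAreasIn (3 +ℕ q) (4 +ℕ q) E uE (ℕP.m<n+m q (s≤s z≤n))
              (enough-points q (length E) 9≤q q^64q≤2^|E|) (excess-ii q 9≤q)
        open SameBaseAreas S
    in p , p∈E , ℕP.<-≤-trans (bound-ii q (length apexes) many) (ℕP.*-monoʳ-≤ 2 (apexes≤V₂pin S)))
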